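{- Let $X,Y$ be sets, $D$ a cpo, and $D^{X_\bot}$ the cpo of continuous functions from $X_\bot$ to $D$ (ordered pointwise). Let $f:D^{X_\bot}\to Y_\bot$ be continuous and let $g\in D^{X_\bot}$ satisfy $f(g)\neq\bot$ and $g(\bot)=\bot$. Then there exists a finite set $F\subseteq X$ such that for every $g'\in D^{X_\bot}$, if $g'(x)=g(x)$ for all $x\in F$ then $f(g')=f(g)$.
   Context: A cpo is a partial order with a least element $\bot$ in which every directed subset (non-empty, and any two elements have an upper bound in it) has a least upper bound. A function between cpos is continuous if it maps directed sets to directed sets and preserves their least upper bounds. For a set $X$, the flat cpo $X_\bot=X\cup\{\bot\}$ is ordered by $x\le y$ iff $x=y$ or $x=\bot$. -}

module Defs where

open import Level using (Level; _⊔_; 0ℓ) renaming (suc to lsuc)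
open import Data.Maybe using (Maybe; just; nothing)
open import Data.Product using (Σ; ∃; _×_; _,_)
open import Data.Sum using (_⊎_)
open import Relation.Binary.PropositionalEquality using (_≡_)
open import Relation.Binary.Structures using (IsPartialOrder)

module _ {a r : Level} {A : Set a} (_≤_ : A → A → Set r) where

  UpperBound : {ℓ : Level} → (A → Set ℓ) → A → Set (a ⊔ ℓ ⊔ r)
  UpperBound S u = ∀ x → S x → x ≤ u

  IsLub : {ℓ : Level} → (A → Set ℓ) → A → Set (a ⊔ ℓ ⊔ r)
  IsLub S l = UpperBound S l × (∀ u → UpperBound S u → l ≤ u)

  Directed : {ℓ : Level} → (A → Set ℓ) → Set (a ⊔ ℓ ⊔ r)
  Directed S = (∃ λ x → S x)
             × (∀ x y → S x → S y → ∃ λ z → S z × (x ≤ z) × (y ≤ z))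

Image : {a b ℓ : Level} {A : Set a} {B : Set b} → (A → B) → (A → Set ℓ) → B → Set (a ⊔ b ⊔ ℓ)
Image {A = A} f S y = ∃ λ (x : A) → S x × (f x ≡ y)

Continuous : {a b r s : Level} {A : Set a} {B : Set b} (ℓ : Level) →
             (A → A → Set r) → (B → B → Set s) → (A → B) → Set (a ⊔ b ⊔ r ⊔ s ⊔ lsuc ℓ)
Continuous {A = A} ℓ _≤A_ _≤B_ f =
  ∀ (S : A → Set ℓ) (l : A) → Directed _≤A_ S → IsLub _≤A_ S l →
    Directed _≤B_ (Image f S) × IsLub _≤B_ (Image f S) (f l)

record Cpo : Set₁ where
  field
    Carrier        : Set
    _⊑_            : Carrier → Carrier → Set
    isPartialOrder : IsPartialOrder _≡_ _⊑_
    ⊥              : Carrier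
    ⊥-least        : ∀ x → ⊥ ⊑ x
    ⨆              : (S : Carrier → Set) → Directed _⊑_ S → Carrier
    ⨆-isLub        : (S : Carrier → Set) (d : Directed _⊑_ S) → IsLub _⊑_ S (⨆ S d)

-- the flat cpo X_⊥ = Maybe X (nothing = ⊥): x ≤ y iff x = y or x = ⊥
_⊑♭_ : {X : Set} → Maybe X → Maybe X → Set
x ⊑♭ y = (x ≡ y) ⊎ (x ≡ nothing)

record CFun (X : Set) (D : Cpo) : Set₁ where
  constructor cfun
  open Cpo D
  field
    fun  : Maybe X → Carrier
    cont : Continuous 0ℓ _⊑♭_ _⊑_ fun

open CFun public

_≤ᶠ_ : {X : Set} {D : Cpo} → CFun X D → CFun X D → Set
_≤ᶠ_ {D = D} h h' = ∀ a → Cpo._⊑_ D (fun h a) (fun h' a)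

-- The finite restrictions g|F (equal to g on F and ⊥ elsewhere) are continuous, form a
-- directed set, and have lub g; here g(⊥) = ⊥ is needed. By continuity f(g) is the lub of
-- the f(g|F) in the flat cpo Y_⊥, and a directed subset of a flat cpo contains its lub, so
-- f(g|F) = f(g) for some F. Any g' agreeing with g on F lies above g|F, so by monotonicity
-- f(g') ⊒ f(g) ≠ ⊥, which in Y_⊥ forces f(g') = f(g).
module Submission where

open import Defs
open import Level using (Level; 0ℓ; lift; lower) renaming (suc to lsuc)
open import Axiom.ExcludedMiddle using (ExcludedMiddle)
open import Data.Maybe using (Maybe; just; nothing)
open import Data.List using (List; []; _∷_; _++_)
open import Data.List.Membership.Propositional using (_∈_)
open import Data.List.Membership.Propositional.Properties using (∈-++⁺ˡ; ∈-++⁺ʳ)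
open import Data.List.Relation.Unary.Any using (here)
open import Data.Product using (∃; _×_; _,_; proj₁; proj₂)
open import Data.Sum using (inj₁; inj₂)
open import Data.Empty using (⊥-elim)
open import Relation.Nullary using (Dec; yes; no; ¬_)
open import Relation.Nullary.Decidable using (map′)
open import Relation.Binary.Definitions using (Reflexive)
open import Relation.Binary.PropositionalEquality using (_≡_; _≢_; refl; sym; trans)
open import Relation.Binary.Structures using (IsPartialOrder)

lowerExcludedMiddle : ∀ {ℓ} → ExcludedMiddle (lsuc ℓ) → ExcludedMiddle ℓ
lowerExcludedMiddle em = map′ lower lift em

module _ {a r : Level} {A : Set a} {_≤_ : A → A → Set r} where

  greatest⇒directed : ∀ {ℓ} {S : A → Set ℓ} {m : A} → S m → UpperBound _≤_ S m → Directed _≤_ S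
  greatest⇒directed {m = m} Sm ub = (m , Sm) , λ x y Sx Sy → m , Sm , ub x Sx , ub y Sy

  greatest⇒isLub : ∀ {ℓ} {S : A → Set ℓ} {m : A} → S m → UpperBound _≤_ S m → IsLub _≤_ S m
  greatest⇒isLub {m = m} Sm ub = ub , λ u ubu → ubu m Sm

  continuous⇒monotone : ∀ {b s} {B : Set b} {_≤B_ : B → B → Set s} {f : A → B} →
    Continuous r _≤_ _≤B_ f → Reflexive _≤_ → ∀ {x y} → x ≤ y → f x ≤B f y
  continuous⇒monotone {f = f} cont refl≤ {x} {y} x≤y =
    proj₁ (proj₂ (cont (_≤ y) y (greatest⇒directed refl≤ (λ _ k≤y → k≤y))
                                (greatest⇒isLub refl≤ (λ _ k≤y → k≤y))))
          (f x) (x , x≤y , refl)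

module _ {A : Set} where

  ⊑♭-nothing : ∀ {x : Maybe A} → x ⊑♭ nothing → x ≡ nothing
  ⊑♭-nothing (inj₁ x≡nothing) = x≡nothing
  ⊑♭-nothing (inj₂ x≡nothing) = x≡nothing

  ⊑♭-defined : ∀ {x y : Maybe A} → x ≢ nothing → x ⊑♭ y → x ≡ y
  ⊑♭-defined _   (inj₁ x≡y) = x≡y
  ⊑♭-defined x≢⊥ (inj₂ x≡⊥) = ⊥-elim (x≢⊥ x≡⊥)

  ∄just⇒nothing : ∀ {ℓ} {S : Maybe A → Set ℓ} → ¬ (∃ λ x → S (just x)) → ∀ z → S z → z ≡ nothing
  ∄just⇒nothing _     nothing  _  = refl
  ∄just⇒nothing ∄just (just x) Sz = ⊥-elim (∄just (x , Sz))

  -- A directed subset of a flat cpo is {⊥}, {a} or {⊥, a}, so it contains its lub;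
  -- telling the first case from the others is where excluded middle is used.
  flat-lub∈ : ∀ {ℓ} {S : Maybe A → Set ℓ} {l : Maybe A} → Dec (∃ λ x → S (just x)) →
    (∃ λ x → S x) → IsLub _⊑♭_ S l → S l
  flat-lub∈ (yes (x , Sx)) _ (ub , _) with ub (just x) Sx
  ... | inj₁ refl = Sx
  flat-lub∈ {S = S} (no ∄just) (s , Ss) (_ , least)
    with ∄just⇒nothing {S = S} ∄just s Ss
       | ⊑♭-nothing (least nothing (λ z Sz → inj₂ (∄just⇒nothing {S = S} ∄just z Sz)))
  ... | refl | refl = Ss

module _ (D : Cpo) where
  open Cpo D
  open IsPartialOrder isPartialOrder using (reflexive) renaming (refl to ⊑-refl; trans to ⊑-trans)

  ≤ᶠ-refl : ∀ {X : Set} (h : CFun X D) → h ≤ᶠ h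
  ≤ᶠ-refl _ _ = ⊑-refl

  strict⇒monotone : ∀ {X : Set} {h : Maybe X → Carrier} → (∀ c → h nothing ⊑ c) →
    ∀ {a b} → a ⊑♭ b → h a ⊑ h b
  strict⇒monotone _      (inj₁ refl) = ⊑-refl
  strict⇒monotone strict (inj₂ refl) = strict _

  strict⇒continuous : ExcludedMiddle 0ℓ → ∀ {X : Set} (h : Maybe X → Carrier) →
    (∀ c → h nothing ⊑ c) → Continuous 0ℓ _⊑♭_ _⊑_ h
  strict⇒continuous em h strict S l (nonempty , _) isLub =
    greatest⇒directed hl∈ hl-ub , greatest⇒isLub hl∈ hl-ub
    where
    hl∈ : Image h S (h l)
    hl∈ = l , flat-lub∈ em nonempty isLub , refl
    hl-ub : UpperBound _⊑_ (Image h S) (h l)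
    hl-ub _ (s , Ss , refl) = strict⇒monotone strict (proj₁ isLub s Ss)

  module Restriction (em : ExcludedMiddle 0ℓ) {X : Set} (g : CFun X D) where

    restrict : List X → Maybe X → Carrier
    restrict F nothing = ⊥
    restrict F (just x) with em {x ∈ F}
    ... | yes _ = fun g (just x)
    ... | no  _ = ⊥

    restrict-∈ : ∀ {F x} → x ∈ F → restrict F (just x) ≡ fun g (just x)
    restrict-∈ {F} {x} x∈F with em {x ∈ F}
    ... | yes _   = refl
    ... | no  x∉F = ⊥-elim (x∉F x∈F)

    restrict-≤ : ∀ F (k : Maybe X → Carrier) →
      (∀ x → x ∈ F → k (just x) ≡ fun g (just x)) → ∀ a → restrict F a ⊑ k a
    restrict-≤ F k agree nothing = ⊥-least _
    restrict-≤ F k agree (just x) with em {x ∈ F}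
    ... | yes x∈F = reflexive (sym (agree x x∈F))
    ... | no  _   = ⊥-least _

    restrictᶜ : List X → CFun X D
    restrictᶜ F = cfun (restrict F) (strict⇒continuous em (restrict F) ⊥-least)

    -- Membership is stated up to pointwise equality: the predicate must live in Set,
    -- whereas equality of CFun X D lives in Set₁.
    Restrictions : CFun X D → Set
    Restrictions h = ∃ λ F → ∀ a → fun h a ≡ restrict F a

    restriction-≤ᶠ : ∀ h F → (∀ a → fun h a ≡ restrict F a) → (g' : CFun X D) →
      (∀ x → x ∈ F → fun g' (just x) ≡ fun g (just x)) → h ≤ᶠ g'
    restriction-≤ᶠ h F h≡g|F g' agree a =
      ⊑-trans (reflexive (h≡g|F a)) (restrict-≤ F (fun g') agree a)

    restrictions-directed : Directed _≤ᶠ_ Restrictions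
    restrictions-directed = (restrictᶜ [] , [] , λ _ → refl) , bound
      where
      bound : ∀ h₁ h₂ → Restrictions h₁ → Restrictions h₂ →
        ∃ λ h → Restrictions h × h₁ ≤ᶠ h × h₂ ≤ᶠ h
      bound h₁ h₂ (F , e₁) (G , e₂) =
        restrictᶜ (F ++ G) , (F ++ G , λ _ → refl) ,
        restriction-≤ᶠ h₁ F e₁ (restrictᶜ (F ++ G)) (λ _ x∈F → restrict-∈ (∈-++⁺ˡ x∈F)) ,
        restriction-≤ᶠ h₂ G e₂ (restrictᶜ (F ++ G)) (λ _ x∈G → restrict-∈ (∈-++⁺ʳ F x∈G))

    restrictions-lub : fun g nothing ≡ ⊥ → IsLub _≤ᶠ_ Restrictions g
    restrictions-lub g⊥≡⊥ = (λ h (F , e) → restriction-≤ᶠ h F e g (λ _ _ → refl)) , least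
      where
      least : ∀ u → UpperBound _≤ᶠ_ Restrictions u → g ≤ᶠ u
      least u ub nothing  = ⊑-trans (reflexive g⊥≡⊥) (⊥-least _)
      least u ub (just x) =
        ⊑-trans (reflexive (sym (restrict-∈ (here refl))))
                (ub (restrictᶜ (x ∷ [])) (x ∷ [] , λ _ → refl) (just x))

lemma6 : ExcludedMiddle (lsuc 0ℓ) →
    (X Y : Set) (D : Cpo) (f : CFun X D → Maybe Y) →
    Continuous 0ℓ _≤ᶠ_ _⊑♭_ f →
    (g : CFun X D) → f g ≢ nothing → fun g nothing ≡ Cpo.⊥ D →
    ∃ λ (F : List X) → ∀ (g' : CFun X D) →
      (∀ x → x ∈ F → fun g' (just x) ≡ fun g (just x)) → f g' ≡ f g
lemma6 em X Y D f f-cont g fg≢⊥ g⊥≡⊥ = support fg-attained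
  where
  open Restriction D (lowerExcludedMiddle em) g

  fg-attained : Image f Restrictions (f g)
  fg-attained with f-cont Restrictions g restrictions-directed (restrictions-lub g⊥≡⊥)
  ... | (nonempty , _) , isLub = flat-lub∈ em nonempty isLub

  support : Image f Restrictions (f g) → ∃ λ (F : List X) → ∀ (g' : CFun X D) →
    (∀ x → x ∈ F → fun g' (just x) ≡ fun g (just x)) → f g' ≡ f g
  support (h , (F , h≡g|F) , fh≡fg) = F , λ g' agree →
    trans (sym (⊑♭-defined fh≢⊥ (f-monotone (restriction-≤ᶠ h F h≡g|F g' agree)))) fh≡fg
    where
    f-monotone : ∀ {k k'} → k ≤ᶠ k' → f k ⊑♭ f k'
    f-monotone = continuous⇒monotone f-cont (λ {k} → ≤ᶠ-refl D k)

    fh≢⊥ : f h ≢ nothing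
    fh≢⊥ fh≡⊥ = fg≢⊥ (trans (sym fh≡fg) fh≡⊥)
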